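{- Every claw-free CIS graph is gem-free.
   Context: All graphs are finite and simple. A graph is CIS if every inclusion-maximal clique intersects every inclusion-maximal stable set. The claw is $K_{1,3}$. The gem is the graph obtained from the path $P_4$ by adding a vertex adjacent to all four vertices. "$H$-free" means having no induced subgraph isomorphic to $H$. -}

module Defs where

open import Data.Nat using (ℕ)
open import Data.Bool using (Bool; true; false)
open import Data.Fin using (Fin; zero; suc)
open import Data.Fin.Subset using (Subset; _∈_; _⊆_)
open import Data.Product using (Σ; _×_; ∃)
open import Relation.Binary.PropositionalEquality using (_≡_; _≢_)
open import Relation.Nullary using (¬_)
open import Function.Definitions using (Injective)

record Graph (n : ℕ) : Set where
  field
    adj   : Fin n → Fin n → Bool
    sym   : ∀ u v → adj u v ≡ adj v u
    irref : ∀ v → adj v v ≡ false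

open Graph public

Adj : ∀ {n} → Graph n → Fin n → Fin n → Set
Adj G u v = adj G u v ≡ true

IsClique : ∀ {n} → Graph n → Subset n → Set
IsClique G S = ∀ u v → u ∈ S → v ∈ S → u ≢ v → Adj G u v

IsStable : ∀ {n} → Graph n → Subset n → Set
IsStable G S = ∀ u v → u ∈ S → v ∈ S → ¬ Adj G u v

IsMaximalClique : ∀ {n} → Graph n → Subset n → Set
IsMaximalClique G S = IsClique G S × (∀ T → IsClique G T → S ⊆ T → T ⊆ S)

IsMaximalStable : ∀ {n} → Graph n → Subset n → Set
IsMaximalStable G S = IsStable G S × (∀ T → IsStable G T → S ⊆ T → T ⊆ S)

IsCIS : ∀ {n} → Graph n → Set
IsCIS G = ∀ C S → IsMaximalClique G C → IsMaximalStable G S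
        → ∃ λ v → v ∈ C × v ∈ S

InducedSub : ∀ {k n} → Graph k → Graph n → Set
InducedSub {k} {n} H G =
  Σ (Fin k → Fin n) λ f → Injective _≡_ _≡_ f × (∀ u v → adj G (f u) (f v) ≡ adj H u v)

_-free : ∀ {k n} → Graph k → Graph n → Set
(H -free) G = ¬ InducedSub H G

clawAdj : Fin 4 → Fin 4 → Bool
clawAdj zero (suc _) = true
clawAdj (suc _) zero = true
clawAdj _ _ = false

claw : Graph 4
claw = record { adj = clawAdj ; sym = s ; irref = i }
  where
  s : ∀ u v → clawAdj u v ≡ clawAdj v u
  s zero zero = Relation.Binary.PropositionalEquality.refl
  s zero (suc _) = Relation.Binary.PropositionalEquality.refl
  s (suc _) zero = Relation.Binary.PropositionalEquality.refl
  s (suc _) (suc _) = Relation.Binary.PropositionalEquality.refl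
  i : ∀ v → clawAdj v v ≡ false
  i zero = Relation.Binary.PropositionalEquality.refl
  i (suc _) = Relation.Binary.PropositionalEquality.refl

-- The gem: path 1-2-3-4 (vertices 1..4) plus vertex 0 adjacent to all.
pathAdj : Fin 4 → Fin 4 → Bool
pathAdj zero (suc zero) = true
pathAdj (suc zero) zero = true
pathAdj (suc zero) (suc (suc zero)) = true
pathAdj (suc (suc zero)) (suc zero) = true
pathAdj (suc (suc zero)) (suc (suc (suc zero))) = true
pathAdj (suc (suc (suc zero))) (suc (suc zero)) = true
pathAdj _ _ = false

gemAdj : Fin 5 → Fin 5 → Bool
gemAdj zero zero = false
gemAdj zero (suc _) = true
gemAdj (suc _) zero = true
gemAdj (suc u) (suc v) = pathAdj u v

gem : Graph 5
gem = record { adj = gemAdj ; sym = s ; irref = i }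
  where
  open Relation.Binary.PropositionalEquality using (refl)
  s : ∀ u v → gemAdj u v ≡ gemAdj v u
  s zero zero = refl
  s zero (suc _) = refl
  s (suc _) zero = refl
  s (suc zero) (suc zero) = refl
  s (suc zero) (suc (suc zero)) = refl
  s (suc zero) (suc (suc (suc zero))) = refl
  s (suc zero) (suc (suc (suc (suc zero)))) = refl
  s (suc (suc zero)) (suc zero) = refl
  s (suc (suc zero)) (suc (suc zero)) = refl
  s (suc (suc zero)) (suc (suc (suc zero))) = refl
  s (suc (suc zero)) (suc (suc (suc (suc zero)))) = refl
  s (suc (suc (suc zero))) (suc zero) = refl
  s (suc (suc (suc zero))) (suc (suc zero)) = refl
  s (suc (suc (suc zero))) (suc (suc (suc zero))) = refl
  s (suc (suc (suc zero))) (suc (suc (suc (suc zero)))) = refl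
  s (suc (suc (suc (suc zero)))) (suc zero) = refl
  s (suc (suc (suc (suc zero)))) (suc (suc zero)) = refl
  s (suc (suc (suc (suc zero)))) (suc (suc (suc zero))) = refl
  s (suc (suc (suc (suc zero)))) (suc (suc (suc (suc zero)))) = refl
  i : ∀ v → gemAdj v v ≡ false
  i zero = refl
  i (suc zero) = refl
  i (suc (suc zero)) = refl
  i (suc (suc (suc zero))) = refl
  i (suc (suc (suc (suc zero)))) = refl

-- Put the triangle formed by the hub and the middle edge b–d of a gem into a
-- maximal clique, and the two ends a, e of its path into a maximal stable set.
-- In a CIS graph these share a vertex v: it sees neither a nor e, hence is not
-- the hub (which sees a) and so is adjacent to it. Also v ≠ a, since v equals
-- or sees d while a does neither; likewise v ≠ e, via b. So the hub, a, e and
-- v induce a claw.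
module Submission where

open import Defs hiding (sym)
open import Data.Nat using (ℕ)
open import Data.Bool using (true; false)
open import Data.Bool.Properties using (¬-not) renaming (_≟_ to _≟ᵇ_)
open import Data.Fin using (Fin; zero; suc)
open import Data.Fin.Properties using (all?) renaming (_≟_ to _≟ᶠ_)
open import Data.Fin.Subset using (Subset; _∈_; _⊆_; _∪_; ⁅_⁆)
open import Data.Fin.Subset.Properties
  using (_∈?_; x∈⁅x⁆; x∈⁅y⁆⇒x≡y; p⊆p∪q; q⊆p∪q; x∈p∪q⁻)
open import Data.List using (List; []; _∷_; allFin)
open import Data.List.Membership.Propositional using () renaming (_∈_ to _∈ˡ_)
open import Data.List.Membership.Propositional.Properties using (∈-allFin)
open import Data.List.Relation.Unary.Any using (here; there)
open import Data.Product using (∃; _×_; _,_)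
open import Data.Sum using (_⊎_; inj₁; inj₂)
open import Function using (_∘_)
open import Function.Definitions using (Injective)
open import Relation.Binary.PropositionalEquality
  using (_≡_; _≢_; refl; sym; trans)
open import Relation.Nullary using (¬_; Dec; yes; no; contradiction)
open import Relation.Nullary.Decidable using (¬?; _→-dec_)

x∈p∪⁅y⁆⁻ : ∀ {n} {p : Subset n} {x y : Fin n} → x ∈ p ∪ ⁅ y ⁆ → x ∈ p ⊎ x ≡ y
x∈p∪⁅y⁆⁻ {p = p} {y = y} x∈ with x∈p∪q⁻ p ⁅ y ⁆ x∈
... | inj₁ x∈p = inj₁ x∈p
... | inj₂ x∈y = inj₂ (x∈⁅y⁆⇒x≡y y x∈y)

p∪⁅x⁆⊆q : ∀ {n} {p q : Subset n} {x : Fin n} → p ⊆ q → x ∈ q → p ∪ ⁅ x ⁆ ⊆ q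
p∪⁅x⁆⊆q p⊆q x∈q y∈ with x∈p∪⁅y⁆⁻ y∈
... | inj₁ y∈p = p⊆q y∈p
... | inj₂ refl = x∈q

module MaximalExtension {n : ℕ} (P : Subset n → Set)
  (P-⊆ : ∀ {S T} → S ⊆ T → P T → P S) (P? : ∀ S → Dec (P S)) where

  extend : List (Fin n) → Subset n → Subset n
  extend [] S = S
  extend (w ∷ ws) S with P? (S ∪ ⁅ w ⁆)
  ... | yes _ = extend ws (S ∪ ⁅ w ⁆)
  ... | no _ = extend ws S

  ⊆-extend : ∀ ws S → S ⊆ extend ws S
  ⊆-extend [] S = λ x∈ → x∈
  ⊆-extend (w ∷ ws) S with P? (S ∪ ⁅ w ⁆)
  ... | yes _ = ⊆-extend ws (S ∪ ⁅ w ⁆) ∘ p⊆p∪q ⁅ w ⁆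
  ... | no _ = ⊆-extend ws S

  extend-P : ∀ ws S → P S → P (extend ws S)
  extend-P [] S PS = PS
  extend-P (w ∷ ws) S PS with P? (S ∪ ⁅ w ⁆)
  ... | yes PS∪w = extend-P ws (S ∪ ⁅ w ⁆) PS∪w
  ... | no _ = extend-P ws S PS

  -- A vertex w rejected at its turn could not be added to any P-superset T
  -- of the result either, because S ∪ ⁅ w ⁆ ⊆ T and P is hereditary.
  extend-maximal : ∀ ws S T → P T → extend ws S ⊆ T →
                   ∀ {w} → w ∈ˡ ws → w ∈ T → w ∈ extend ws S
  extend-maximal (w ∷ ws) S T PT ext⊆T (here refl) w∈T with P? (S ∪ ⁅ w ⁆)
  ... | yes _ = ⊆-extend ws (S ∪ ⁅ w ⁆) (q⊆p∪q S ⁅ w ⁆ (x∈⁅x⁆ w))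
  ... | no ¬PS∪w = contradiction (P-⊆ (p∪⁅x⁆⊆q (ext⊆T ∘ ⊆-extend ws S) w∈T) PT) ¬PS∪w
  extend-maximal (w ∷ ws) S T PT ext⊆T (there w∈ws) w∈T with P? (S ∪ ⁅ w ⁆)
  ... | yes _ = extend-maximal ws (S ∪ ⁅ w ⁆) T PT ext⊆T w∈ws w∈T
  ... | no _ = extend-maximal ws S T PT ext⊆T w∈ws w∈T

  maximal : Subset n → Subset n
  maximal = extend (allFin n)

  ⊆-maximal : ∀ S → S ⊆ maximal S
  ⊆-maximal = ⊆-extend (allFin n)

  maximal-P : ∀ S → P S → P (maximal S)
  maximal-P = extend-P (allFin n)

  maximal-isMaximal : ∀ S T → P T → maximal S ⊆ T → T ⊆ maximal S
  maximal-isMaximal S T PT max⊆T {w} = extend-maximal (allFin n) S T PT max⊆T (∈-allFin w)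

module _ {n : ℕ} (G : Graph n) where

  Adj-sym : ∀ {u v} → Adj G u v → Adj G v u
  Adj-sym {u} {v} uv = trans (Graph.sym G v u) uv

  ≡false⇒¬Adj : ∀ {u v} → adj G u v ≡ false → ¬ Adj G u v
  ≡false⇒¬Adj uv≡false uv with trans (sym uv≡false) uv
  ... | ()

  ¬Adj-refl : ∀ v → ¬ Adj G v v
  ¬Adj-refl v = ≡false⇒¬Adj (Graph.irref G v)

  Adj⇒≢ : ∀ {u v} → Adj G u v → u ≢ v
  Adj⇒≢ {u} uv refl = ¬Adj-refl u uv

  IsClique-⊆ : ∀ {S T} → S ⊆ T → IsClique G T → IsClique G S
  IsClique-⊆ S⊆T T-clique u v u∈ v∈ = T-clique u v (S⊆T u∈) (S⊆T v∈)

  IsStable-⊆ : ∀ {S T} → S ⊆ T → IsStable G T → IsStable G S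
  IsStable-⊆ S⊆T T-stable u v u∈ v∈ = T-stable u v (S⊆T u∈) (S⊆T v∈)

  isClique? : ∀ S → Dec (IsClique G S)
  isClique? S = all? λ u → all? λ v →
    (u ∈? S) →-dec ((v ∈? S) →-dec (¬? (u ≟ᶠ v) →-dec (adj G u v ≟ᵇ true)))

  isStable? : ∀ S → Dec (IsStable G S)
  isStable? S = all? λ u → all? λ v →
    (u ∈? S) →-dec ((v ∈? S) →-dec ¬? (adj G u v ≟ᵇ true))

  IsClique-⁅⁆ : ∀ w → IsClique G ⁅ w ⁆
  IsClique-⁅⁆ w u v u∈ v∈ u≢v = contradiction (trans (x∈⁅y⁆⇒x≡y w u∈) (sym (x∈⁅y⁆⇒x≡y w v∈))) u≢v

  IsClique-∪⁅⁆ : ∀ {K w} → IsClique G K → (∀ {x} → x ∈ K → x ≢ w → Adj G x w) →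
                 IsClique G (K ∪ ⁅ w ⁆)
  IsClique-∪⁅⁆ K-clique w-joined u v u∈ v∈ u≢v with x∈p∪⁅y⁆⁻ u∈ | x∈p∪⁅y⁆⁻ v∈
  ... | inj₁ u∈K | inj₁ v∈K = K-clique u v u∈K v∈K u≢v
  ... | inj₁ u∈K | inj₂ refl = w-joined u∈K u≢v
  ... | inj₂ refl | inj₁ v∈K = Adj-sym (w-joined v∈K (u≢v ∘ sym))
  ... | inj₂ refl | inj₂ refl = contradiction refl u≢v

  IsStable-⁅⁆ : ∀ w → IsStable G ⁅ w ⁆
  IsStable-⁅⁆ w u v u∈ v∈ with x∈⁅y⁆⇒x≡y w u∈ | x∈⁅y⁆⇒x≡y w v∈
  ... | refl | refl = ¬Adj-refl w

  IsStable-∪⁅⁆ : ∀ {I w} → IsStable G I → (∀ {x} → x ∈ I → ¬ Adj G x w) →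
                 IsStable G (I ∪ ⁅ w ⁆)
  IsStable-∪⁅⁆ I-stable w-missed u v u∈ v∈ with x∈p∪⁅y⁆⁻ u∈ | x∈p∪⁅y⁆⁻ v∈
  ... | inj₁ u∈I | inj₁ v∈I = I-stable u v u∈I v∈I
  ... | inj₁ u∈I | inj₂ refl = w-missed u∈I
  ... | inj₂ refl | inj₁ v∈I = w-missed v∈I ∘ Adj-sym
  ... | inj₂ refl | inj₂ refl = ¬Adj-refl u

  Dominates : Fin n → Subset n → Set
  Dominates v K = ∀ {x} → x ∈ K → v ≡ x ⊎ Adj G v x

  Misses : Fin n → Subset n → Set
  Misses v I = ∀ {y} → y ∈ I → ¬ Adj G v y

  ≢-by-closedNeighbourhood : ∀ {v w x} → v ≡ x ⊎ Adj G v x → w ≢ x → ¬ Adj G w x → v ≢ w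
  ≢-by-closedNeighbourhood (inj₁ v≡x) w≢x _ refl = w≢x v≡x
  ≢-by-closedNeighbourhood (inj₂ vx) _ ¬wx refl = ¬wx vx

  IsCIS⇒dominating-missing-vertex : IsCIS G → ∀ {K I} → IsClique G K → IsStable G I →
                                    ∃ λ v → Dominates v K × Misses v I
  IsCIS⇒dominating-missing-vertex cis {K} {I} K-clique I-stable =
    common-vertex (cis C S (C-clique , Clique.maximal-isMaximal K)
                           (S-stable , Stable.maximal-isMaximal I))
    where
    module Clique = MaximalExtension (IsClique G) IsClique-⊆ isClique?
    module Stable = MaximalExtension (IsStable G) IsStable-⊆ isStable?

    C S : Subset n
    C = Clique.maximal K
    S = Stable.maximal I

    C-clique : IsClique G C
    C-clique = Clique.maximal-P K K-clique

    S-stable : IsStable G S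
    S-stable = Stable.maximal-P I I-stable

    common-vertex : (∃ λ v → v ∈ C × v ∈ S) → ∃ λ v → Dominates v K × Misses v I
    common-vertex (v , v∈C , v∈S) = v , dominates , misses
      where
      dominates : Dominates v K
      dominates {x} x∈K with v ≟ᶠ x
      ... | yes v≡x = inj₁ v≡x
      ... | no v≢x = inj₂ (C-clique v x v∈C (Clique.⊆-maximal K x∈K) v≢x)

      misses : Misses v I
      misses y∈I = S-stable v _ v∈S (Stable.⊆-maximal I y∈I)

  claw-induced : ∀ {c x y z} → Adj G c x → Adj G c y → Adj G c z →
                 ¬ Adj G x y → ¬ Adj G x z → ¬ Adj G y z →
                 x ≢ y → x ≢ z → y ≢ z → InducedSub claw G
  claw-induced {c} {x} {y} {z} cx cy cz ¬xy ¬xz ¬yz x≢y x≢z y≢z = g , g-injective , g-adj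
    where
    g : Fin 4 → Fin n
    g zero = c
    g (suc zero) = x
    g (suc (suc zero)) = y
    g (suc (suc (suc zero))) = z

    g-injective : Injective _≡_ _≡_ g
    g-injective {zero} {zero} _ = refl
    g-injective {zero} {suc zero} c≡x = contradiction c≡x (Adj⇒≢ cx)
    g-injective {zero} {suc (suc zero)} c≡y = contradiction c≡y (Adj⇒≢ cy)
    g-injective {zero} {suc (suc (suc zero))} c≡z = contradiction c≡z (Adj⇒≢ cz)
    g-injective {suc zero} {zero} x≡c = contradiction (sym x≡c) (Adj⇒≢ cx)
    g-injective {suc zero} {suc zero} _ = refl
    g-injective {suc zero} {suc (suc zero)} x≡y = contradiction x≡y x≢y
    g-injective {suc zero} {suc (suc (suc zero))} x≡z = contradiction x≡z x≢z
    g-injective {suc (suc zero)} {zero} y≡c = contradiction (sym y≡c) (Adj⇒≢ cy)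
    g-injective {suc (suc zero)} {suc zero} y≡x = contradiction (sym y≡x) x≢y
    g-injective {suc (suc zero)} {suc (suc zero)} _ = refl
    g-injective {suc (suc zero)} {suc (suc (suc zero))} y≡z = contradiction y≡z y≢z
    g-injective {suc (suc (suc zero))} {zero} z≡c = contradiction (sym z≡c) (Adj⇒≢ cz)
    g-injective {suc (suc (suc zero))} {suc zero} z≡x = contradiction (sym z≡x) x≢z
    g-injective {suc (suc (suc zero))} {suc (suc zero)} z≡y = contradiction (sym z≡y) y≢z
    g-injective {suc (suc (suc zero))} {suc (suc (suc zero))} _ = refl

    g-adj : ∀ u v → adj G (g u) (g v) ≡ adj claw u v
    g-adj zero zero = Graph.irref G c
    g-adj zero (suc zero) = cx
    g-adj zero (suc (suc zero)) = cy
    g-adj zero (suc (suc (suc zero))) = cz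
    g-adj (suc zero) zero = Adj-sym cx
    g-adj (suc zero) (suc zero) = Graph.irref G x
    g-adj (suc zero) (suc (suc zero)) = ¬-not ¬xy
    g-adj (suc zero) (suc (suc (suc zero))) = ¬-not ¬xz
    g-adj (suc (suc zero)) zero = Adj-sym cy
    g-adj (suc (suc zero)) (suc zero) = ¬-not (¬xy ∘ Adj-sym)
    g-adj (suc (suc zero)) (suc (suc zero)) = Graph.irref G y
    g-adj (suc (suc zero)) (suc (suc (suc zero))) = ¬-not ¬yz
    g-adj (suc (suc (suc zero))) zero = Adj-sym cz
    g-adj (suc (suc (suc zero))) (suc zero) = ¬-not (¬xz ∘ Adj-sym)
    g-adj (suc (suc (suc zero))) (suc (suc zero)) = ¬-not (¬yz ∘ Adj-sym)
    g-adj (suc (suc (suc zero))) (suc (suc (suc zero))) = Graph.irref G z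

  module GemEmbedding (f : Fin 5 → Fin n) (f-injective : Injective _≡_ _≡_ f)
                      (f-adj : ∀ u v → adj G (f u) (f v) ≡ adj gem u v) where

    hub a b d e : Fin n
    hub = f zero
    a = f (suc zero)
    b = f (suc (suc zero))
    d = f (suc (suc (suc zero)))
    e = f (suc (suc (suc (suc zero))))

    triangle ends : Subset n
    triangle = (⁅ hub ⁆ ∪ ⁅ b ⁆) ∪ ⁅ d ⁆
    ends = ⁅ a ⁆ ∪ ⁅ e ⁆

    triangle-isClique : IsClique G triangle
    triangle-isClique = IsClique-∪⁅⁆ (IsClique-∪⁅⁆ (IsClique-⁅⁆ hub) hub-b) hub,b-d
      where
      hub-b : ∀ {x} → x ∈ ⁅ hub ⁆ → x ≢ b → Adj G x b
      hub-b x∈ _ with x∈⁅y⁆⇒x≡y hub x∈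
      ... | refl = f-adj zero (suc (suc zero))

      hub,b-d : ∀ {x} → x ∈ ⁅ hub ⁆ ∪ ⁅ b ⁆ → x ≢ d → Adj G x d
      hub,b-d x∈ _ with x∈p∪⁅y⁆⁻ x∈
      ... | inj₁ x∈hub rewrite x∈⁅y⁆⇒x≡y hub x∈hub = f-adj zero (suc (suc (suc zero)))
      ... | inj₂ refl = f-adj (suc (suc zero)) (suc (suc (suc zero)))

    ends-isStable : IsStable G ends
    ends-isStable = IsStable-∪⁅⁆ (IsStable-⁅⁆ a) a-e
      where
      a-e : ∀ {x} → x ∈ ⁅ a ⁆ → ¬ Adj G x e
      a-e x∈ rewrite x∈⁅y⁆⇒x≡y a x∈ = ≡false⇒¬Adj (f-adj (suc zero) (suc (suc (suc (suc zero)))))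

    dominating-missing-vertex⇒claw : (∃ λ v → Dominates v triangle × Misses v ends) →
                                     InducedSub claw G
    dominating-missing-vertex⇒claw (v , dominates , misses) =
      claw-induced (f-adj zero (suc zero)) (f-adj zero (suc (suc (suc (suc zero))))) (Adj-sym v-hub)
                   (≡false⇒¬Adj (f-adj (suc zero) (suc (suc (suc (suc zero))))))
                   (misses a∈ends ∘ Adj-sym) (misses e∈ends ∘ Adj-sym)
                   (f-≢ (λ ())) (v≢a ∘ sym) (v≢e ∘ sym)
      where
      f-≢ : ∀ {i j} → i ≢ j → f i ≢ f j
      f-≢ i≢j = i≢j ∘ f-injective

      a∈ends : a ∈ ends
      a∈ends = p⊆p∪q ⁅ e ⁆ (x∈⁅x⁆ a)
      e∈ends : e ∈ ends
      e∈ends = q⊆p∪q ⁅ a ⁆ ⁅ e ⁆ (x∈⁅x⁆ e)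

      hub∈triangle : hub ∈ triangle
      hub∈triangle = p⊆p∪q ⁅ d ⁆ (p⊆p∪q ⁅ b ⁆ (x∈⁅x⁆ hub))
      b∈triangle : b ∈ triangle
      b∈triangle = p⊆p∪q ⁅ d ⁆ (q⊆p∪q ⁅ hub ⁆ ⁅ b ⁆ (x∈⁅x⁆ b))
      d∈triangle : d ∈ triangle
      d∈triangle = q⊆p∪q (⁅ hub ⁆ ∪ ⁅ b ⁆) ⁅ d ⁆ (x∈⁅x⁆ d)

      v-hub : Adj G v hub
      v-hub with dominates hub∈triangle
      ... | inj₁ refl = contradiction (f-adj zero (suc zero)) (misses a∈ends)
      ... | inj₂ v-hub = v-hub

      v≢a : v ≢ a
      v≢a = ≢-by-closedNeighbourhood (dominates d∈triangle) (f-≢ (λ ()))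
              (≡false⇒¬Adj (f-adj (suc zero) (suc (suc (suc zero)))))

      v≢e : v ≢ e
      v≢e = ≢-by-closedNeighbourhood (dominates b∈triangle) (f-≢ (λ ()))
              (≡false⇒¬Adj (f-adj (suc (suc (suc (suc zero)))) (suc (suc zero))))

lemma7 : ∀ (n : ℕ) (G : Graph n) → (claw -free) G → IsCIS G → (gem -free) G
lemma7 n G claw-free cis (f , f-injective , f-adj) =
  claw-free (dominating-missing-vertex⇒claw
    (IsCIS⇒dominating-missing-vertex G cis triangle-isClique ends-isStable))
  where open GemEmbedding G f f-injective f-adj
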